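{- Let $G$ be an Abelian group, let $H\le G$ be a subgroup, and let $\mathcal{S}\subset G/H$ be a set of $s$ cosets of $H$. Then the union $\bigcup\mathcal{S}$ of these cosets is $(s+1)$-stable.
   Context: For $k\in\mathbb{N}$, a set $A\subset G$ has the $k$-order property if there are vectors $a,b\in G^k$ such that for all $1\le i,j\le k$, $a_i+b_j\in A$ if and only if $i\le j$; if $A$ does not have the $k$-order property it is called $k$-stable. -}

module Defs where

open import Level using (Level; _⊔_; suc)
open import Algebra.Bundles using (AbelianGroup)
open import Data.Nat using (ℕ)
open import Data.Fin using (Fin; _≤_)
open import Data.Product using (Σ; ∃; _×_)
open import Relation.Nullary using (¬_)
open import Relation.Binary.PropositionalEquality using (_≢_)
open import Function.Bundles using (_⇔_)

module _ {c ℓ : Level} (G : AbelianGroup c ℓ) where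
  open AbelianGroup G

  Subset : (p : Level) → Set (c ⊔ suc p)
  Subset p = Carrier → Set p

  record IsSubgroup {p : Level} (H : Subset p) : Set (c ⊔ ℓ ⊔ p) where
    field
      resp   : ∀ {x y} → x ≈ y → H x → H y
      ε-mem  : H ε
      ∙-mem  : ∀ {x y} → H x → H y → H (x ∙ y)
      ⁻¹-mem : ∀ {x} → H x → H (x ⁻¹)

  UnionOfCosets : {p : Level} (H : Subset p) {s : ℕ} (g : Fin s → Carrier) → Subset p
  UnionOfCosets H {s} g x = Σ (Fin s) λ i → H (x - g i)

  DistinctCosets : {p : Level} (H : Subset p) {s : ℕ} (g : Fin s → Carrier) → Set p
  DistinctCosets H g = ∀ i j → i ≢ j → ¬ H (g i - g j)

  OrderProperty : {p : Level} → ℕ → Subset p → Set (c ⊔ p)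
  OrderProperty k A = Σ (Fin k → Carrier) λ a → Σ (Fin k → Carrier) λ b →
    ∀ i j → (A (a i ∙ b j) ⇔ (i ≤ j))

  Stable : {p : Level} → ℕ → Subset p → Set (c ⊔ p)
  Stable k A = ¬ OrderProperty k A

module Submission where

-- Write x ∼ y for "x and y lie in the same coset of H", i.e. H (x - y).
-- This is an equivalence relation that is invariant under translation,
-- and A, being a union of cosets, is closed under it.  Suppose a, b
-- witness the (s+1)-order property.  Since 0 ≤ j for every j, the s+1
-- elements a₀ + b_j all lie in A, hence by the pigeonhole principle two
-- of them, for indices j < k, lie in the same coset; cancelling a₀ gives
-- b_j ∼ b_k.  Translating by a_k, a_k + b_j ∼ a_k + b_k ∈ A (as k ≤ k),
-- so a_k + b_j ∈ A and the order property forces k ≤ j, contradicting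
-- j < k.

open import Defs
open import Level using (Level)
open import Algebra.Bundles using (AbelianGroup)
open import Data.Nat using (ℕ; suc; z≤n)
open import Data.Nat.Properties using (n<1+n; <⇒≱)
open import Data.Fin using (Fin; zero; _<_; _≤_)
open import Data.Fin.Properties using (pigeonhole; ≤-refl)
open import Data.Product using (∃₂; _×_; _,_; proj₁; proj₂)
open import Function.Bundles using (Equivalence)
import Relation.Binary.PropositionalEquality as ≡
import Algebra.Properties.Group as GroupProperties
import Algebra.Properties.AbelianGroup as AbelianGroupProperties
import Relation.Binary.Reasoning.Setoid as SetoidReasoning

module Differences {c ℓ : Level} (G : AbelianGroup c ℓ) where
  open AbelianGroup G
  open GroupProperties group using (⁻¹-anti-homo-∙; \\-leftDividesʳ; //-rightDividesʳ)
  open SetoidReasoning setoid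

  difference-chain : ∀ x y z → (x - y) ∙ (y - z) ≈ x - z
  difference-chain x y z = begin
    (x ∙ y ⁻¹) ∙ (y ∙ z ⁻¹)  ≈⟨ assoc x (y ⁻¹) (y ∙ z ⁻¹) ⟩
    x ∙ (y ⁻¹ ∙ (y ∙ z ⁻¹))  ≈⟨ ∙-congˡ (\\-leftDividesʳ y (z ⁻¹)) ⟩
    x ∙ z ⁻¹                 ∎

  difference-translateʳ : ∀ x y w → (x ∙ w) - (y ∙ w) ≈ x - y
  difference-translateʳ x y w = begin
    (x ∙ w) ∙ (y ∙ w) ⁻¹        ≈⟨ ∙-congˡ (⁻¹-anti-homo-∙ y w) ⟩
    (x ∙ w) ∙ (w ⁻¹ ∙ y ⁻¹)     ≈⟨ sym (assoc (x ∙ w) (w ⁻¹) (y ⁻¹)) ⟩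
    ((x ∙ w) ∙ w ⁻¹) ∙ y ⁻¹     ≈⟨ ∙-congʳ (//-rightDividesʳ w x) ⟩
    x ∙ y ⁻¹                    ∎

  difference-translateˡ : ∀ w x y → (w ∙ x) - (w ∙ y) ≈ x - y
  difference-translateˡ w x y = begin
    (w ∙ x) - (w ∙ y)  ≈⟨ -‿cong (comm w x) (comm w y) ⟩
    (x ∙ w) - (y ∙ w)  ≈⟨ difference-translateʳ x y w ⟩
    x - y              ∎
    where
    -‿cong : ∀ {x x′ y y′} → x ≈ x′ → y ≈ y′ → x - y ≈ x′ - y′
    -‿cong x≈x′ y≈y′ = ∙-cong x≈x′ (⁻¹-cong y≈y′)

module SameCoset {c ℓ p : Level} (G : AbelianGroup c ℓ) (H : Subset G p)
                 (H-subgroup : IsSubgroup G H) where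
  open AbelianGroup G
  open IsSubgroup H-subgroup
  open Differences G
  open AbelianGroupProperties G using (⁻¹-anti-homo‿-)

  _∼_ : Carrier → Carrier → Set p
  x ∼ y = H (x - y)

  ∼-sym : ∀ {x y} → x ∼ y → y ∼ x
  ∼-sym {x} {y} x∼y = resp (⁻¹-anti-homo‿- x y) (⁻¹-mem x∼y)

  ∼-trans : ∀ {x y z} → x ∼ y → y ∼ z → x ∼ z
  ∼-trans {x} {y} {z} x∼y y∼z = resp (difference-chain x y z) (∙-mem x∼y y∼z)

  ∼-translateˡ : ∀ w {x y} → x ∼ y → (w ∙ x) ∼ (w ∙ y)
  ∼-translateˡ w {x} {y} = resp (sym (difference-translateˡ w x y))

  ∼-cancelˡ : ∀ w {x y} → (w ∙ x) ∼ (w ∙ y) → x ∼ y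
  ∼-cancelˡ w {x} {y} = resp (difference-translateˡ w x y)

  union-saturated : ∀ {s} (g : Fin s → Carrier) {x y} →
    UnionOfCosets G H g x → y ∼ x → UnionOfCosets G H g y
  union-saturated g (i , x∼gᵢ) y∼x = i , ∼-trans y∼x x∼gᵢ

  union-pigeonhole : ∀ {s} (g : Fin s → Carrier) (f : Fin (suc s) → Carrier) →
    (∀ j → UnionOfCosets G H g (f j)) → ∃₂ λ j k → j < k × f j ∼ f k
  union-pigeonhole {s} g f f∈A
    with j , k , j<k , same-index ← pigeonhole (n<1+n s) (λ j → proj₁ (f∈A j))
    = j , k , j<k , ∼-trans (proj₂ (f∈A j)) (∼-sym fₖ∼gᵢ)
    where
    fₖ∼gᵢ : f k ∼ g (proj₁ (f∈A j))
    fₖ∼gᵢ = ≡.subst (λ i → f k ∼ g i) (≡.sym same-index) (proj₂ (f∈A k))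

  -- The union of s cosets of H does not have the (s+1)-order property:
  -- a collision b_j ∼ b_k (j < k) in row 0 puts a_k + b_j in A.
  union-stable : (s : ℕ) (g : Fin s → Carrier) → Stable G (suc s) (UnionOfCosets G H g)
  union-stable s g (a , b , order)
    with j , k , j<k , a₀bⱼ∼a₀bₖ ← union-pigeonhole g (λ j → a zero ∙ b j)
                                     (λ j → Equivalence.from (order zero j) z≤n)
    = <⇒≱ j<k k≤j
    where
    bⱼ∼bₖ : b j ∼ b k
    bⱼ∼bₖ = ∼-cancelˡ (a zero) a₀bⱼ∼a₀bₖ

    aₖbₖ∈A : UnionOfCosets G H g (a k ∙ b k)
    aₖbₖ∈A = Equivalence.from (order k k) (≤-refl {x = k})

    k≤j : k ≤ j
    k≤j = Equivalence.to (order k j)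
            (union-saturated g aₖbₖ∈A (∼-translateˡ (a k) bⱼ∼bₖ))

lemma1p5 : {c ℓ p : Level} (G : AbelianGroup c ℓ) (H : Subset G p) → IsSubgroup G H →
    (s : ℕ) (g : Fin s → AbelianGroup.Carrier G) → DistinctCosets G H g →
    Stable G (suc s) (UnionOfCosets G H g)
lemma1p5 G H H-subgroup s g _ = SameCoset.union-stable G H H-subgroup s g
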